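{- Let $G$ be a directed simple $st$-graph that does not contain a subgraph homeomorphic to the Wheatstone graph $W$, and let $C$ be a simple directed cycle in $G$. Then some edge of $C$ can be removed from $G$ so that the resulting graph $G'$ satisfies $\mathrm{Path}_A(G')=\mathrm{Path}_A(G)$.
   Context: A directed simple $st$-graph is a finite directed graph without self-loops or parallel edges, with distinguished source $s$ (no incoming edges) and sink $t\ne s$ (no outgoing edges), every vertex lying on some directed walk from $s$ to $t$. $\mathrm{Path}_A(G)$ denotes the set of acyclic (simple) directed paths from $s$ to $t$ in $G$. $W$ is the graph with vertices $s,u,v,t$ and edges $s\to u$, $s\to v$, $u\to v$, $u\to t$, $v\to t$. $G$ contains a subgraph homeomorphic to $W$ if a graph isomorphic to $W$ can be obtained from $G$ by a sequence of the operations: delete an edge; delete an isolated vertex; whenever $(x,y)$ is the only edge entering $y$ and $(y,z)$ the only edge leaving $y$, replace $(x,y),(y,z)$ by $(x,z)$ and delete $y$. -}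

module Defs where

open import Data.Nat using (ℕ)
open import Data.Fin using (Fin; zero; suc)
open import Data.Fin.Properties using (_≟_)
open import Data.Bool using (Bool; true; false; _∧_; if_then_else_)
open import Data.List using (List; []; _∷_; _++_; [_])
open import Data.List.Relation.Unary.Linked using (Linked)
open import Data.List.Relation.Unary.Unique.Propositional using (Unique)
open import Data.Product using (Σ; ∃; _×_; _,_)
open import Relation.Nullary using (¬_)
open import Relation.Nullary.Decidable using (⌊_⌋)
open import Relation.Binary.PropositionalEquality using (_≡_; _≢_)
open import Relation.Binary.Construct.Closure.ReflexiveTransitive using (Star)
open import Function.Definitions using (Injective)

-- A finite directed graph without parallel edges on vertex set Fin n:
-- the edge relation is a Boolean matrix.
EdgeRel : ℕ → Set
EdgeRel n = Fin n → Fin n → Bool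

Edge : ∀ {n} → EdgeRel n → Fin n → Fin n → Set
Edge E x y = E x y ≡ true

record IsSTGraph {n : ℕ} (E : EdgeRel n) (s t : Fin n) : Set where
  field
    noLoops   : ∀ x → E x x ≡ false
    s≢t       : s ≢ t
    noIntoS   : ∀ x → E x s ≡ false
    noOutOfT  : ∀ x → E t x ≡ false
    onWalk    : ∀ v → Star (Edge E) s v × Star (Edge E) v t

-- Acyclic (simple) directed s-t paths, as vertex sequences
-- (in a graph without parallel edges a path is determined by its vertices).
IsPathA : ∀ {n} → EdgeRel n → Fin n → Fin n → List (Fin n) → Set
IsPathA {n} E s t p =
  Σ (List (Fin n)) λ mid → (p ≡ s ∷ (mid ++ [ t ])) × Linked (Edge E) p × Unique p

SamePathA : ∀ {n} → EdgeRel n → EdgeRel n → Fin n → Fin n → Set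
SamePathA {n} E E′ s t =
  ∀ (p : List (Fin n)) → (IsPathA E s t p → IsPathA E′ s t p) × (IsPathA E′ s t p → IsPathA E s t p)

removeEdge : ∀ {n} → EdgeRel n → Fin n → Fin n → EdgeRel n
removeEdge E a b x y = if ⌊ x ≟ a ⌋ ∧ ⌊ y ≟ b ⌋ then false else E x y

-- Simple directed cycle x₀ x₁ … x_{k-1} (listed without repetition), with
-- edges x_i → x_{i+1} and x_{k-1} → x₀.
closeUp : ∀ {n} → List (Fin n) → List (Fin n)
closeUp []       = []
closeUp (x ∷ xs) = x ∷ (xs ++ [ x ])

IsSimpleCycle : ∀ {n} → EdgeRel n → List (Fin n) → Set
IsSimpleCycle E c = (c ≢ []) × Unique c × Linked (Edge E) (closeUp c)

data ConsecPair {A : Set} (a b : A) : List A → Set where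
  here  : ∀ {xs} → ConsecPair a b (a ∷ b ∷ xs)
  there : ∀ {x xs} → ConsecPair a b xs → ConsecPair a b (x ∷ xs)

CycleEdge : ∀ {n} → List (Fin n) → Fin n → Fin n → Set
CycleEdge c a b = ConsecPair a b (closeUp c)

-- Homeomorphic subgraphs.
-- Intermediate graphs obtained by the operations live on the same
-- vertex type Fin n, with a Boolean vertex-presence predicate.

record PGraph (n : ℕ) : Set where
  constructor pg
  field
    vtx  : Fin n → Bool
    edge : Fin n → Fin n → Bool
open PGraph public

full : ∀ {n} → EdgeRel n → PGraph n
full E = pg (λ _ → true) E

data Step {n : ℕ} : PGraph n → PGraph n → Set where
  delEdge : ∀ H a b → edge H a b ≡ true →
            Step H (pg (vtx H) (removeEdge (edge H) a b))
  delVtx  : ∀ H v → vtx H v ≡ true →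
            (∀ w → edge H v w ≡ false) → (∀ w → edge H w v ≡ false) →
            Step H (pg (λ w → if ⌊ w ≟ v ⌋ then false else vtx H w) (edge H))
  smooth  : ∀ H x y z → x ≢ y → y ≢ z →
            edge H x y ≡ true → edge H y z ≡ true →
            (∀ w → edge H w y ≡ true → w ≡ x) →
            (∀ w → edge H y w ≡ true → w ≡ z) →
            Step H (pg (λ w → if ⌊ w ≟ y ⌋ then false else vtx H w)
                       (λ a b → if ⌊ a ≟ x ⌋ ∧ ⌊ b ≟ z ⌋ then true
                                else removeEdge (removeEdge (edge H) x y) y z a b))

-- The Wheatstone graph W on Fin 4 with s = 0, u = 1, v = 2, t = 3:
-- edges s→u, s→v, u→v, u→t, v→t.
W : EdgeRel 4
W zero (suc zero) = true
W zero (suc (suc zero)) = true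
W (suc zero) (suc (suc zero)) = true
W (suc zero) (suc (suc (suc zero))) = true
W (suc (suc zero)) (suc (suc (suc zero))) = true
W _ _ = false

IsoW : ∀ {n} → PGraph n → Set
IsoW {n} H =
  Σ (Fin 4 → Fin n) λ f →
    Injective _≡_ _≡_ f ×
    (∀ i → vtx H (f i) ≡ true) ×
    (∀ v → vtx H v ≡ true → ∃ λ i → f i ≡ v) ×
    (∀ i j → edge H (f i) (f j) ≡ W i j) ×
    (∀ a b → edge H a b ≡ true → (∃ λ i → f i ≡ a) × (∃ λ j → f j ≡ b))

ContainsHomeoW : ∀ {n} → EdgeRel n → Set
ContainsHomeoW E = ∃ λ H → Star Step (full E) H × IsoW H

module Submission where

-- Write u ≺ v when some acyclic s-t path visits u strictly before v.  The key structural
-- fact is that two acyclic s-t paths p, q visiting two vertices in opposite orders force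
-- a subdivision of W: suitably extremal common vertices a, x, y, d of p and q (`frame`)
-- cut p and q into five internally disjoint paths a→x, a→y, x→y, x→d, y→d, and deleting
-- everything else and smoothing the inner vertices yields W (`subdivision⇒homeomorphic`).
-- So ≺ is irreflexive (paths are acyclic) and, if G is W-free, asymmetric; splicing two
-- paths at a shared vertex then shows that it is transitive.  An edge (a , b) lying on an acyclic s-t path gives
-- a ≺ b, so if every edge of the cycle c → ⋯ → c were on such a path we would get c ≺ c.
-- Hence some cycle edge lies on no acyclic s-t path, and removing it keeps Path_A(G).

open import Defs
import Algebra.Solver.CommutativeMonoid as CommutativeMonoidSolver
open import Data.Bool using (Bool; true; false; _∧_; if_then_else_)
open import Data.Bool.Properties as Bool using (¬-not)
open import Data.Empty using (⊥; ⊥-elim)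
open import Data.Fin using (Fin; zero; suc; toℕ)
open import Data.Fin.Properties using (_≟_; toℕ-injective)
open import Data.List using (List; []; _∷_; _++_; [_]; length; take; drop; allFin; map; concatMap; cartesianProduct; initLast; _∷ʳ′_)
open import Data.List.Properties using (take-[]; ++-assoc; length-++; ∷-injectiveʳ; ∷ʳ-injectiveʳ; ++-conicalʳ; length-tabulate)
open import Data.List.Membership.Propositional using (_∈_; _∉_; lose)
open import Data.List.Membership.Propositional.Properties using (∈-∃++; ∈-++⁺ˡ; ∈-++⁺ʳ; ∈-++⁻; ∈-allFin; ∈-cartesianProduct⁺; ∈-concatMap⁺; ∈-map⁺)
open import Data.List.Relation.Binary.Permutation.Propositional using (_↭_; ↭-refl; ↭⇒↭ₛ)
open import Data.List.Relation.Binary.Permutation.Propositional.Properties using (++-commutativeMonoid)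
import Data.List.Relation.Binary.Permutation.Setoid.Properties as PermutationProperties
open import Data.List.Relation.Unary.All using (All; []; _∷_)
import Data.List.Relation.Unary.All as All
open import Data.List.Relation.Unary.AllPairs using ([]; _∷_; allPairs?)
open import Data.List.Relation.Unary.Any using (Any; here; there; any?; satisfied)
import Data.List.Relation.Unary.Any.Properties as Any
open import Data.List.Relation.Unary.Linked using (Linked; []; [-]; _∷_; linked?)
import Data.List.Relation.Unary.Linked as Linked
open import Data.List.Relation.Unary.Unique.Propositional using (Unique)
import Data.List.Relation.Unary.Unique.Propositional.Properties as Unique
open import Data.Maybe using (Maybe; just; nothing)
open import Data.Maybe.Properties using (just-injective)
open import Data.Nat using (ℕ; zero; suc; _+_; _∸_; _<_; _≤_; z≤n; s≤s; _<?_)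
open import Data.Nat.Properties using (anyUpTo?; ≤-refl; <-trans; <⇒≤; <-irrefl; <-asym; <-≤-trans; ≤-pred; ≤∧≢⇒<; <-cmp; m≤n⇒m<n∨m≡n; m≤n⇒m≤1+n; n≤1+n; m≤m+n; m+[n∸m]≡n; +-suc)
open import Data.Product using (Σ; ∃; ∃₂; _×_; _,_; proj₁; proj₂)
open import Data.Sum using (_⊎_; inj₁; inj₂; [_,_]′)
open import Function using (_∘_; id; case_of_)
open import Relation.Binary.Construct.Closure.ReflexiveTransitive using (Star; ε; _◅_; _◅◅_)
open import Relation.Binary.Definitions using (DecidableEquality; tri<; tri≈; tri>)
open import Relation.Binary.PropositionalEquality using (_≡_; _≢_; refl; sym; trans; cong; cong₂; subst; setoid; module ≡-Reasoning)
open import Relation.Nullary using (¬_; Dec; yes; no; ¬?)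
open import Relation.Nullary.Decidable using (⌊_⌋; _×-dec_)
open import Relation.Unary using (Decidable)

module _ {A : Set} where

  _at_ : List A → ℕ → Maybe A
  []       at _     = nothing
  (x ∷ xs) at zero  = just x
  (x ∷ xs) at suc i = xs at i

  at-∈ : ∀ {xs : List A} {i v} → xs at i ≡ just v → v ∈ xs
  at-∈ {x ∷ xs} {zero}  e = here (sym (just-injective e))
  at-∈ {x ∷ xs} {suc i} e = there (at-∈ {xs} e)

  ∈-at : ∀ {xs : List A} {v} → v ∈ xs → ∃ λ i → xs at i ≡ just v
  ∈-at (here refl) = zero , refl
  ∈-at (there v∈xs) with i , e ← ∈-at v∈xs = suc i , e

  at-< : ∀ {xs : List A} {i v} → xs at i ≡ just v → i < length xs
  at-< {x ∷ xs} {zero}  e = s≤s z≤n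
  at-< {x ∷ xs} {suc i} e = s≤s (at-< {xs} e)

  at-injective : ∀ {xs : List A} {i j v} → Unique xs → xs at i ≡ just v → xs at j ≡ just v → i ≡ j
  at-injective {x ∷ xs} {zero}  {zero}  _ _ _ = refl
  at-injective {x ∷ xs} {zero}  {suc j} (x∉ ∷ _) e e′ = ⊥-elim (All.lookup x∉ (at-∈ {xs} e′) (just-injective e))
  at-injective {x ∷ xs} {suc i} {zero}  (x∉ ∷ _) e e′ = ⊥-elim (All.lookup x∉ (at-∈ {xs} e) (just-injective e′))
  at-injective {x ∷ xs} {suc i} {suc j} (_ ∷ u) e e′ = cong suc (at-injective u e e′)

  Before : List A → A → A → Set
  Before L u v = ∃₂ λ i j → i < j × L at i ≡ just u × L at j ≡ just v

  at-drop : ∀ (xs : List A) m k → drop m xs at k ≡ xs at (m + k)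
  at-drop []       zero    k = refl
  at-drop []       (suc m) k = refl
  at-drop (x ∷ xs) zero    k = refl
  at-drop (x ∷ xs) (suc m) k = at-drop xs m k

  -- Segments: `span L i j` occupies the positions i, i+1, …, j-1 of L.
  take-+ : ∀ m n (xs : List A) → take (m + n) xs ≡ take m xs ++ take n (drop m xs)
  take-+ zero    n xs       = refl
  take-+ (suc m) n []       = sym (take-[] n)
  take-+ (suc m) n (x ∷ xs) = cong (x ∷_) (take-+ m n xs)

  span : List A → ℕ → ℕ → List A
  span L i j = take (j ∸ i) (drop i L)

  span-unique : ∀ {L} i j → Unique L → Unique (span L i j)
  span-unique i j u = Unique.take⁺ (j ∸ i) (Unique.drop⁺ i u)

  span-[] : ∀ i j → span [] i j ≡ []
  span-[] zero    j = take-[] j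
  span-[] (suc i) j = take-[] (j ∸ suc i)

  ∈-span : ∀ L {i j v} → v ∈ span L i j → ∃ λ k → i ≤ k × k < j × L at k ≡ just v
  ∈-span []      {i} {j} v∈ rewrite span-[] i j with () ← v∈
  ∈-span (x ∷ L) {zero}  {suc j} (here refl) = zero , z≤n , s≤s z≤n , refl
  ∈-span (x ∷ L) {zero}  {suc j} (there v∈)
    with k , _ , k<j , e ← ∈-span L {zero} {j} v∈ = suc k , z≤n , s≤s k<j , e
  ∈-span (x ∷ L) {suc i} {suc j} v∈
    with k , i≤k , k<j , e ← ∈-span L {i} {j} v∈ = suc k , s≤s i≤k , s≤s k<j , e

  span-split : ∀ L {i j k} → i ≤ j → j ≤ k → span L i k ≡ span L i j ++ span L j k
  span-split L       {zero}  {j} {k} _ j≤k =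
    trans (cong (λ m → take m L) (sym (m+[n∸m]≡n j≤k))) (take-+ j (k ∸ j) L)
  span-split []      {suc i} {j} {k} _ _ rewrite span-[] (suc i) k | span-[] (suc i) j | span-[] j k = refl
  span-split (x ∷ L) {suc i} (s≤s i≤j) (s≤s j≤k) = span-split L i≤j j≤k

  span-head : ∀ L {i j v} → L at i ≡ just v → i < j → span L i j ≡ v ∷ span L (suc i) j
  span-head (x ∷ L) {zero}  {suc j} e _ with refl ← just-injective e = refl
  span-head (x ∷ L) {suc i} {suc j} e (s≤s i<j) = span-head L e i<j

  span-unit : ∀ L {j v} → L at j ≡ just v → span L j (suc j) ≡ [ v ]
  span-unit (x ∷ L) {zero}  e with refl ← just-injective e = refl
  span-unit (x ∷ L) {suc j} e = span-unit L e

  between : List A → ℕ → ℕ → List A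
  between L i j = span L (suc i) j

  span-closed : ∀ L {i j u w} → L at i ≡ just u → L at j ≡ just w → i < j →
                span L i (suc j) ≡ u ∷ between L i j ++ [ w ]
  span-closed L {i} {j} {u} {w} eu ew i<j = begin
    span L i (suc j)                ≡⟨ span-split L (<⇒≤ i<j) (n≤1+n j) ⟩
    span L i j ++ span L j (suc j)  ≡⟨ cong₂ _++_ (span-head L eu i<j) (span-unit L ew) ⟩
    u ∷ between L i j ++ [ w ]      ∎
    where open ≡-Reasoning

  at-++ˡ : ∀ (X : List A) {Y} k → k < length X → (X ++ Y) at k ≡ X at k
  at-++ˡ (x ∷ X) zero    _         = refl
  at-++ˡ (x ∷ X) (suc k) (s≤s k<X) = at-++ˡ X k k<X

  at-++ʳ : ∀ (X : List A) {Y} m → (X ++ Y) at (length X + m) ≡ Y at m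
  at-++ʳ []      m = refl
  at-++ʳ (x ∷ X) m = at-++ʳ X m

  at-take : ∀ (L : List A) {j k} → k < j → take j L at k ≡ L at k
  at-take []      {suc j} {k}     _         = refl
  at-take (x ∷ L) {suc j} {zero}  _         = refl
  at-take (x ∷ L) {suc j} {suc k} (s≤s k<j) = at-take L k<j

  length-take : ∀ (L : List A) {j} → j ≤ length L → length (take j L) ≡ j
  length-take L       {zero}  _         = refl
  length-take (x ∷ L) {suc j} (s≤s j≤L) = cong suc (length-take L j≤L)

  at-snoc : ∀ (X : List A) {v} → (X ++ [ v ]) at length X ≡ just v
  at-snoc []      = refl
  at-snoc (x ∷ X) = at-snoc X

  length-snoc : ∀ (X : List A) {v} → length (X ++ [ v ]) ≡ suc (length X)
  length-snoc []      = refl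
  length-snoc (x ∷ X) = cong suc (length-snoc X)

  drop-at : ∀ (L : List A) i {v} → L at i ≡ just v → drop i L ≡ v ∷ drop (suc i) L
  drop-at (x ∷ L) zero    e with refl ← just-injective e = refl
  drop-at (x ∷ L) (suc i) e = drop-at L i e

  drop-++ : ∀ (X : List A) {Y} i → i ≤ length X → drop i (X ++ Y) ≡ drop i X ++ Y
  drop-++ X       zero    _         = refl
  drop-++ (x ∷ X) (suc i) (s≤s i≤X) = drop-++ X i i≤X

  ∈-drop : ∀ (L : List A) {i v} → v ∈ drop i L → ∃ λ k → i ≤ k × L at k ≡ just v
  ∈-drop L {i} v∈ with k , e ← ∈-at v∈ = i + k , m≤m+n i k , trans (sym (at-drop L i k)) e

  ∈-del : ∀ (X : List A) {y C v} → v ∈ X ++ y ∷ C → v ≢ y → v ∈ X ++ C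
  ∈-del []      (here refl) v≢y = ⊥-elim (v≢y refl)
  ∈-del []      (there v∈)  _   = v∈
  ∈-del (x ∷ X) (here refl) _   = here refl
  ∈-del (x ∷ X) (there v∈)  v≢y = there (∈-del X v∈ v≢y)

  ∈-ins : ∀ (X : List A) {y C v} → v ∈ X ++ C → v ∈ X ++ y ∷ C
  ∈-ins []      v∈          = there v∈
  ∈-ins (x ∷ X) (here refl) = here refl
  ∈-ins (x ∷ X) (there v∈)  = there (∈-ins X v∈)

  unique-del : ∀ (X : List A) {y C} → Unique (X ++ y ∷ C) → Unique (X ++ C)
  unique-del []      (_ ∷ u)   = u
  unique-del (x ∷ X) (x∉ ∷ u) =
    All.tabulate (λ v∈ → All.lookup x∉ (∈-ins X v∈)) ∷ unique-del X u

  unique-middle∉ : ∀ (X : List A) {y C} → Unique (X ++ y ∷ C) → y ∉ X ++ C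
  unique-middle∉ []      (y∉ ∷ _) y∈         = All.lookup y∉ y∈ refl
  unique-middle∉ (x ∷ X) (x∉ ∷ _) (here refl) = All.lookup x∉ (∈-++⁺ʳ X (here refl)) refl
  unique-middle∉ (x ∷ X) (_ ∷ u)  (there y∈)  = unique-middle∉ X u y∈

  unique-length : ∀ {xs ys : List A} → Unique xs → (∀ {v} → v ∈ xs → v ∈ ys) → length xs ≤ length ys
  unique-length {[]}     _         _  = z≤n
  unique-length {x ∷ xs} (x∉ ∷ u) xs⊆ with ys₁ , ys₂ , refl ← ∈-∃++ (xs⊆ (here refl)) =
    subst (suc (length xs) ≤_) (sym (trans (length-++ ys₁) (+-suc (length ys₁) (length ys₂))))
      (s≤s (subst (length xs ≤_) (length-++ ys₁)
        (unique-length u (λ v∈ → ∈-del ys₁ (xs⊆ (there v∈)) (λ { refl → All.lookup x∉ v∈ refl })))))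

module _ {A : Set} {R : A → A → Set} where

  linked-take : ∀ {L : List A} m → Linked R L → Linked R (take m L)
  linked-take {[]}             zero          _       = []
  linked-take {[]}             (suc m)       _       = []
  linked-take {x ∷ L}          zero          _       = []
  linked-take {x ∷ []}         (suc zero)    _       = [-]
  linked-take {x ∷ []}         (suc (suc m)) _       = [-]
  linked-take {x ∷ y ∷ L}      (suc zero)    _       = [-]
  linked-take {x ∷ y ∷ L}      (suc (suc m)) (r ∷ l) = r ∷ linked-take (suc m) l

  linked-drop : ∀ {L : List A} m → Linked R L → Linked R (drop m L)
  linked-drop {[]}    zero    _ = []
  linked-drop {[]}    (suc m) _ = []
  linked-drop {x ∷ L} zero    l = l
  linked-drop {x ∷ L} (suc m) l = linked-drop m (Linked.tail l)

  linked-between : ∀ {L : List A} {i j u w} → Linked R L → L at i ≡ just u → L at j ≡ just w → i < j →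
                   Linked R (u ∷ between L i j ++ [ w ])
  linked-between {L} {i} {j} l eu ew i<j =
    subst (Linked R) (span-closed L eu ew i<j) (linked-take (suc j ∸ i) (linked-drop i l))

  linked-join : ∀ {L : List A} {j v D} → Linked R L → L at j ≡ just v →
                Linked R (v ∷ D) → Linked R (take j L ++ v ∷ D)
  linked-join {L}             {zero}        _       _ lD = lD
  linked-join {x ∷ y ∷ L}     {suc zero}    (r ∷ _) e lD with refl ← just-injective e = r ∷ lD
  linked-join {x ∷ y ∷ L}     {suc (suc j)} (r ∷ l) e lD = r ∷ linked-join {y ∷ L} {suc j} l e lD

  linked-pair : ∀ {L : List A} {a b} → Linked R L → ConsecPair a b L → R a b
  linked-pair (r ∷ _) here      = r
  linked-pair (_ ∷ l) (there c) = linked-pair l c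

  linked-relabel : ∀ {S : A → A → Set} {L : List A} → Linked R L →
                   (∀ {x y} → ConsecPair x y L → R x y → S x y) → Linked S L
  linked-relabel []      _ = []
  linked-relabel [-]     _ = [-]
  linked-relabel (r ∷ l) f = f here r ∷ linked-relabel l (f ∘ there)

module _ {A : Set} where

  cp-fst : ∀ {a b : A} {L} → ConsecPair a b L → a ∈ L
  cp-fst here      = here refl
  cp-fst (there c) = there (cp-fst c)

  cp-snd : ∀ {a b : A} {L} → ConsecPair a b L → b ∈ L
  cp-snd here      = there (here refl)
  cp-snd (there c) = there (cp-snd c)

  cp-positions : ∀ {a b} {L : List A} → ConsecPair a b L → Before L a b
  cp-positions here = 0 , 1 , s≤s z≤n , refl , refl
  cp-positions (there c) with i , j , i<j , ea , eb ← cp-positions c = suc i , suc j , s≤s i<j , ea , eb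

  cp? : DecidableEquality A → ∀ (a b : A) L → Dec (ConsecPair a b L)
  cp? _≟_ a b []          = no λ ()
  cp? _≟_ a b (x ∷ [])    = no λ { (there ()) }
  cp? _≟_ a b (x ∷ y ∷ L) with a ≟ x | b ≟ y | cp? _≟_ a b (y ∷ L)
  ... | yes refl | yes refl | _     = yes here
  ... | _        | _        | yes c = yes (there c)
  ... | no a≢x   | _        | no ¬c = no λ { here → a≢x refl ; (there c) → ¬c c }
  ... | yes _    | no b≢y   | no ¬c = no λ { here → b≢y refl ; (there c) → ¬c c }

module _ {P : ℕ → Set} (P? : Decidable P) where

  least : ∀ B → (∃ λ m → m < B × P m) → ∃ λ l → l < B × P l × (∀ l′ → l′ < l → ¬ P l′)
  least (suc B) w with anyUpTo? P? B
  ... | yes w′ with l , l<B , pl , below ← least B w′ = l , m≤n⇒m≤1+n l<B , pl , below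
  least (suc B) (m , s≤s m≤B , pm) | no none =
    m , s≤s m≤B , pm , λ l′ l′<m pl′ → none (l′ , <-≤-trans l′<m m≤B , pl′)

  greatest : ∀ B → (∃ λ m → m < B × P m) → ∃ λ l → l < B × P l × (∀ l′ → l < l′ → l′ < B → ¬ P l′)
  greatest (suc B) w with P? B
  ... | yes pB = B , ≤-refl , pB , λ l′ B<l′ l′<1+B _ → <-irrefl refl (<-≤-trans B<l′ (≤-pred l′<1+B))
  greatest (suc B) (m , s≤s m≤B , pm) | no ¬pB with m≤n⇒m<n∨m≡n m≤B
  ... | inj₂ refl = ⊥-elim (¬pB pm)
  ... | inj₁ m<B with l , l<B , pl , above ← greatest B (m , m<B , pm) =
    l , m≤n⇒m≤1+n l<B , pl , beyond
    where
    beyond : ∀ l′ → l < l′ → l′ < suc B → ¬ P l′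
    beyond l′ l<l′ (s≤s l′≤B) with m≤n⇒m<n∨m≡n l′≤B
    ... | inj₁ l′<B = above l′ l<l′ l′<B
    ... | inj₂ refl = ¬pB

below-greatest : ∀ {P : ℕ → Set} {B l m} → (∀ l′ → l < l′ → l′ < B → ¬ P l′) → m < B → P m → m ≤ l
below-greatest {l = l} {m} above m<B pm with <-cmp m l
... | tri< m<l _ _ = <⇒≤ m<l
... | tri≈ _ refl _ = ≤-refl
... | tri> _ _ l<m = ⊥-elim (above m l<m m<B pm)

unless-absent : ∀ {P : Set} {b} → P ⊎ b ≡ false → b ≡ true → P
unless-absent (inj₁ p)    _  = p
unless-absent (inj₂ refl) ()

bool-≡ : ∀ {b c : Bool} → (b ≡ true → c ≡ true) → (c ≡ true → b ≡ true) → b ≡ c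
bool-≡ {false} {false} _ _ = refl
bool-≡ {false} {true}  _ g = g refl
bool-≡ {true}  {false} f _ = sym (f refl)
bool-≡ {true}  {true}  _ _ = refl

if-true : ∀ c {r} → (if c then true else r) ≡ true → c ≡ true ⊎ r ≡ true
if-true true  _ = inj₁ refl
if-true false h = inj₂ h

if-else-true : ∀ c {r} → r ≡ true → (if c then true else r) ≡ true
if-else-true true  _ = refl
if-else-true false h = h

module _ {n : ℕ} where

  removeEdge-true : ∀ (e : EdgeRel n) a₀ b₀ a b → removeEdge e a₀ b₀ a b ≡ true →
                    e a b ≡ true × ¬ (a ≡ a₀ × b ≡ b₀)
  removeEdge-true e a₀ b₀ a b h with a ≟ a₀ | b ≟ b₀
  removeEdge-true e a₀ b₀ a b () | yes refl | yes refl
  ... | yes _    | no b≢b₀  = h , b≢b₀ ∘ proj₂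
  ... | no a≢a₀  | _        = h , a≢a₀ ∘ proj₁

  removeEdge-other : ∀ (e : EdgeRel n) a₀ b₀ a b → ¬ (a ≡ a₀ × b ≡ b₀) → removeEdge e a₀ b₀ a b ≡ e a b
  removeEdge-other e a₀ b₀ a b ne with a ≟ a₀ | b ≟ b₀
  ... | yes refl | yes refl = ⊥-elim (ne (refl , refl))
  ... | yes _    | no _     = refl
  ... | no _     | _        = refl

  deleteVtx : (Fin n → Bool) → Fin n → Fin n → Bool
  deleteVtx vt v w = if ⌊ w ≟ v ⌋ then false else vt w

  deleteVtx-true : ∀ vt v w → deleteVtx vt v w ≡ true → w ≢ v × vt w ≡ true
  deleteVtx-true vt v w h with w ≟ v
  deleteVtx-true vt v w () | yes _
  ... | no w≢v = w≢v , h

  deleteVtx-other : ∀ vt v w → w ≢ v → deleteVtx vt v w ≡ vt w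
  deleteVtx-other vt v w w≢v with w ≟ v
  ... | yes w≡v = ⊥-elim (w≢v w≡v)
  ... | no _    = refl

  both-equal : ∀ (a x b z : Fin n) → ⌊ a ≟ x ⌋ ∧ ⌊ b ≟ z ⌋ ≡ true → a ≡ x × b ≡ z
  both-equal a x b z h with a ≟ x | b ≟ z
  ... | yes a≡x | yes b≡z = a≡x , b≡z
  both-equal a x b z () | yes _ | no _
  both-equal a x b z () | no _  | _

  smoothEdges : EdgeRel n → Fin n → Fin n → Fin n → EdgeRel n
  smoothEdges e x y z a b = if ⌊ a ≟ x ⌋ ∧ ⌊ b ≟ z ⌋ then true else removeEdge (removeEdge e x y) y z a b

  smoothEdges-true : ∀ e x y z a b → smoothEdges e x y z a b ≡ true →
                     (a ≡ x × b ≡ z) ⊎ (e a b ≡ true × ¬ (a ≡ x × b ≡ y) × ¬ (a ≡ y × b ≡ z))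
  smoothEdges-true e x y z a b h with if-true (⌊ a ≟ x ⌋ ∧ ⌊ b ≟ z ⌋) h
  ... | inj₁ new = inj₁ (both-equal a x b z new)
  ... | inj₂ old with old′ , ¬yz ← removeEdge-true (removeEdge e x y) y z a b old
                 with old″ , ¬xy ← removeEdge-true e x y a b old′ = inj₂ (old″ , ¬xy , ¬yz)

  smoothEdges-new : ∀ e x y z → smoothEdges e x y z x z ≡ true
  smoothEdges-new e x y z with x ≟ x | z ≟ z
  ... | yes _   | yes _   = refl
  ... | no x≢x  | _       = ⊥-elim (x≢x refl)
  ... | yes _   | no z≢z  = ⊥-elim (z≢z refl)

  smoothEdges-keep : ∀ e x y z a b → e a b ≡ true → a ≢ y → b ≢ y → smoothEdges e x y z a b ≡ true
  smoothEdges-keep e x y z a b h a≢y b≢y = if-else-true (⌊ a ≟ x ⌋ ∧ ⌊ b ≟ z ⌋)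
    (trans (removeEdge-other (removeEdge e x y) y z a b (a≢y ∘ proj₁))
           (trans (removeEdge-other e x y a b (b≢y ∘ proj₂)) h))

-- A branch of a subdivided W: the W-edge from → to, subdivided by the inner vertices.
record Branch (n : ℕ) : Set where
  constructor branch
  field
    from to : Fin 4
    inner   : List (Fin n)

module Realisation {n : ℕ} (f : Fin 4 → Fin n) where

  corners : List (Fin n)
  corners = f zero ∷ f (suc zero) ∷ f (suc (suc zero)) ∷ f (suc (suc (suc zero))) ∷ []

  corner∈ : ∀ i → f i ∈ corners
  corner∈ zero                   = here refl
  corner∈ (suc zero)             = there (here refl)
  corner∈ (suc (suc zero))       = there (there (here refl))
  corner∈ (suc (suc (suc zero))) = there (there (there (here refl)))

  branchPath : Branch n → List (Fin n)
  branchPath (branch i j m) = f i ∷ m ++ [ f j ]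

  BranchEdge : List (Branch n) → Fin n → Fin n → Set
  BranchEdge bs a b = Any (λ β → ConsecPair a b (branchPath β)) bs

  BranchEdge? : ∀ bs a b → Dec (BranchEdge bs a b)
  BranchEdge? bs a b = any? (λ β → cp? _≟_ a b (branchPath β)) bs

  inners : List (Branch n) → List (Fin n)
  inners []                   = []
  inners (branch _ _ m ∷ bs) = m ++ inners bs

  support : List (Branch n) → List (Fin n)
  support bs = corners ++ inners bs

  support-corner : ∀ bs {v} → v ∈ corners → v ∈ support bs
  support-corner bs = ∈-++⁺ˡ

  support-inner : ∀ {i j} m bs {v} → v ∈ m → v ∈ support (branch i j m ∷ bs)
  support-inner m bs v∈ = ∈-++⁺ʳ corners (∈-++⁺ˡ v∈)

  support-rest : ∀ {i j} m bs {v} → v ∈ support bs → v ∈ support (branch i j m ∷ bs)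
  support-rest m bs v∈ with ∈-++⁻ corners v∈
  ... | inj₁ v∈c = ∈-++⁺ˡ v∈c
  ... | inj₂ v∈i = ∈-++⁺ʳ corners (∈-++⁺ʳ m v∈i)

  branchPath⊆support : ∀ β bs {v} → v ∈ branchPath β → v ∈ support (β ∷ bs)
  branchPath⊆support (branch i j m) bs (here refl) = support-corner (branch i j m ∷ bs) (corner∈ i)
  branchPath⊆support (branch i j m) bs (there v∈) with ∈-++⁻ m v∈
  ... | inj₁ v∈m        = support-inner {i} {j} m bs v∈m
  ... | inj₂ (here refl) = support-corner (branch i j m ∷ bs) (corner∈ j)

  branchEdge-ends : ∀ {bs a b} → BranchEdge bs a b → a ∈ support bs × b ∈ support bs
  branchEdge-ends {β ∷ bs} (here c) = branchPath⊆support β bs (cp-fst c) , branchPath⊆support β bs (cp-snd c)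
  branchEdge-ends {branch i j m ∷ bs} (there c) with a∈ , b∈ ← branchEdge-ends {bs} c =
    support-rest {i} {j} m bs a∈ , support-rest {i} {j} m bs b∈

  record Realises (H : PGraph n) (bs : List (Branch n)) : Set where
    field
      unique  : Unique (support bs)
      vtx⊆    : ∀ v → vtx H v ≡ true → v ∈ support bs
      ⊆vtx    : ∀ v → v ∈ support bs → vtx H v ≡ true
      edge⊆   : ∀ a b → edge H a b ≡ true → BranchEdge bs a b
      ⊆edge   : ∀ a b → BranchEdge bs a b → edge H a b ≡ true

  snoc-uncons : ∀ (m : List (Fin n)) w → ∃₂ λ z L → m ++ [ w ] ≡ z ∷ L
  snoc-uncons []      w = w , [] , refl
  snoc-uncons (z ∷ m) w = z , m ++ [ w ] , refl

  -- Smoothing away the first inner vertex y of the first branch x → y → z → ⋯ of a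
  -- realised subdivision; m ++ [ f j ] = z ∷ L lists the rest of that branch.
  module SmoothFirst {H i j y m bs} (R : Realises H (branch i j (y ∷ m) ∷ bs))
                     {z L} (m++j≡ : m ++ [ f j ] ≡ z ∷ L) where
    open Realises R

    x : Fin n
    x = f i

    old new : List (Branch n)
    old = branch i j (y ∷ m) ∷ bs
    new = branch i j m ∷ bs

    H′ : PGraph n
    H′ = pg (deleteVtx (vtx H) y) (smoothEdges (edge H) x y z)

    -- Since the support is duplicate-free, y occurs nowhere else.
    ≢y : ∀ {v} → v ∈ support new → v ≢ y
    ≢y v∈ refl = unique-middle∉ corners unique v∈

    rest∈new : ∀ {v} → v ∈ z ∷ L → v ∈ support new
    rest∈new v∈ with ∈-++⁻ m (subst (_ ∈_) (sym m++j≡) v∈)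
    ... | inj₁ v∈m         = support-inner {i} {j} m bs v∈m
    ... | inj₂ (here refl) = support-corner new (corner∈ j)

    bs⊆new : ∀ {v} → v ∈ support bs → v ∈ support new
    bs⊆new = support-rest {i} {j} m bs

    x≢y : x ≢ y
    x≢y = ≢y (support-corner new (corner∈ i))

    y≢z : y ≢ z
    y≢z y≡z = ≢y (rest∈new (here refl)) (sym y≡z)

    oldPath : branchPath (branch i j (y ∷ m)) ≡ x ∷ y ∷ z ∷ L
    oldPath = cong (λ r → x ∷ y ∷ r) m++j≡

    newPath : branchPath (branch i j m) ≡ x ∷ z ∷ L
    newPath = cong (x ∷_) m++j≡

    oldEdge : ∀ {a b} → BranchEdge old a b → ConsecPair a b (x ∷ y ∷ z ∷ L) ⊎ BranchEdge bs a b
    oldEdge (here c)  = inj₁ (subst (ConsecPair _ _) oldPath c)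
    oldEdge (there c) = inj₂ c

    mkOld : ∀ {a b} → ConsecPair a b (x ∷ y ∷ z ∷ L) → BranchEdge old a b
    mkOld c = here (subst (ConsecPair _ _) (sym oldPath) c)

    mkNew : ∀ {a b} → ConsecPair a b (x ∷ z ∷ L) → BranchEdge new a b
    mkNew c = here (subst (ConsecPair _ _) (sym newPath) c)

    into-y : ∀ w → edge H w y ≡ true → w ≡ x
    into-y w h with oldEdge (edge⊆ w y h)
    ... | inj₁ here              = refl
    ... | inj₁ (there here)      = ⊥-elim (y≢z refl)
    ... | inj₁ (there (there c)) = ⊥-elim (≢y (rest∈new (cp-snd c)) refl)
    ... | inj₂ c                 = ⊥-elim (≢y (bs⊆new (proj₂ (branchEdge-ends c))) refl)

    out-of-y : ∀ w → edge H y w ≡ true → w ≡ z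
    out-of-y w h with oldEdge (edge⊆ y w h)
    ... | inj₁ here              = ⊥-elim (x≢y refl)
    ... | inj₁ (there here)      = refl
    ... | inj₁ (there (there c)) = ⊥-elim (≢y (rest∈new (cp-fst c)) refl)
    ... | inj₂ c                 = ⊥-elim (≢y (bs⊆new (proj₁ (branchEdge-ends c))) refl)

    step : Step H H′
    step = smooth H x y z x≢y y≢z (⊆edge x y (mkOld here)) (⊆edge y z (mkOld (there here))) into-y out-of-y

    edge⊆′ : ∀ a b → smoothEdges (edge H) x y z a b ≡ true → BranchEdge new a b
    edge⊆′ a b h with smoothEdges-true (edge H) x y z a b h
    ... | inj₁ (refl , refl) = mkNew here
    ... | inj₂ (h′ , ¬xy , ¬yz) with oldEdge (edge⊆ a b h′)
    ... | inj₁ here              = ⊥-elim (¬xy (refl , refl))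
    ... | inj₁ (there here)      = ⊥-elim (¬yz (refl , refl))
    ... | inj₁ (there (there c)) = mkNew (there c)
    ... | inj₂ c                 = there c

    ⊆edge′ : ∀ a b → BranchEdge new a b → smoothEdges (edge H) x y z a b ≡ true
    ⊆edge′ a b (here c) with subst (ConsecPair _ _) newPath c
    ... | here     = smoothEdges-new (edge H) x y z
    ... | there c′ = smoothEdges-keep (edge H) x y z a b (⊆edge a b (mkOld (there (there c′))))
                       (≢y (rest∈new (cp-fst c′))) (≢y (rest∈new (cp-snd c′)))
    ⊆edge′ a b (there c) = smoothEdges-keep (edge H) x y z a b (⊆edge a b (there c))
                             (≢y (bs⊆new (proj₁ (branchEdge-ends c)))) (≢y (bs⊆new (proj₂ (branchEdge-ends c))))

    realises : Realises H′ new
    realises = record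
      { unique = unique-del corners unique
      ; vtx⊆   = λ v h → let (v≢y , h′) = deleteVtx-true (vtx H) y v h in ∈-del corners (vtx⊆ v h′) v≢y
      ; ⊆vtx   = λ v v∈ → trans (deleteVtx-other (vtx H) y v (≢y v∈)) (⊆vtx v (∈-ins corners v∈))
      ; edge⊆  = edge⊆′
      ; ⊆edge  = ⊆edge′
      }

  smooth-first : ∀ {H i j y m bs} → Realises H (branch i j (y ∷ m) ∷ bs) →
                 ∃ λ H′ → Step H H′ × Realises H′ (branch i j m ∷ bs)
  smooth-first {j = j} {m = m} R with z , L , m++j≡ ← snoc-uncons m (f j) =
    SmoothFirst.H′ R m++j≡ , SmoothFirst.step R m++j≡ , SmoothFirst.realises R m++j≡

  smooth-branch : ∀ {i j} m {bs H} → Realises H (branch i j m ∷ bs) →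
                  ∃ λ H′ → Star Step H H′ × Realises H′ (branch i j [] ∷ bs)
  smooth-branch []      R = _ , ε , R
  smooth-branch (y ∷ m) R with H₁ , s₁ , R₁ ← smooth-first R
                          with H₂ , s₂ , R₂ ← smooth-branch m R₁ = H₂ , s₁ ◅ s₂ , R₂

  inners-snoc : ∀ (bs : List (Branch n)) i j → inners (bs ++ [ branch i j [] ]) ≡ inners bs
  inners-snoc []                   i j = refl
  inners-snoc (branch _ _ m ∷ bs) i j = cong (m ++_) (inners-snoc bs i j)

  rotate : ∀ {H i j} bs → Realises H (branch i j [] ∷ bs) → Realises H (bs ++ [ branch i j [] ])
  rotate {H} {i} {j} bs R = record
    { unique = subst Unique support≡ unique
    ; vtx⊆   = λ v h → subst (v ∈_) support≡ (vtx⊆ v h)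
    ; ⊆vtx   = λ v v∈ → ⊆vtx v (subst (v ∈_) (sym support≡) v∈)
    ; edge⊆  = λ a b h → Any.++-comm [ branch i j [] ] bs (edge⊆ a b h)
    ; ⊆edge  = λ a b c → ⊆edge a b (Any.++-comm bs [ branch i j [] ] c)
    }
    where
    open Realises R
    support≡ : support (branch i j [] ∷ bs) ≡ support (bs ++ [ branch i j [] ])
    support≡ = cong (corners ++_) (sym (inners-snoc bs i j))

  -- The five branches of a subdivided W, following the edges s→u, s→v, u→v, u→t, v→t.
  wBranches : (m₀₁ m₀₂ m₁₂ m₁₃ m₂₃ : List (Fin n)) → List (Branch n)
  wBranches m₀₁ m₀₂ m₁₂ m₁₃ m₂₃ =
    branch zero (suc zero) m₀₁ ∷ branch zero (suc (suc zero)) m₀₂ ∷ branch (suc zero) (suc (suc zero)) m₁₂ ∷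
    branch (suc zero) (suc (suc (suc zero))) m₁₃ ∷ branch (suc (suc zero)) (suc (suc (suc zero))) m₂₃ ∷ []

  smooth-all : ∀ {H} m₀₁ m₀₂ m₁₂ m₁₃ m₂₃ → Realises H (wBranches m₀₁ m₀₂ m₁₂ m₁₃ m₂₃) →
               ∃ λ H′ → Star Step H H′ × Realises H′ (wBranches [] [] [] [] [])
  smooth-all m₀₁ m₀₂ m₁₂ m₁₃ m₂₃ R
    with H₁ , s₁ , R₁ ← smooth-branch m₀₁ R
    with H₂ , s₂ , R₂ ← smooth-branch m₀₂ (rotate _ R₁)
    with H₃ , s₃ , R₃ ← smooth-branch m₁₂ (rotate _ R₂)
    with H₄ , s₄ , R₄ ← smooth-branch m₁₃ (rotate _ R₃)
    with H₅ , s₅ , R₅ ← smooth-branch m₂₃ (rotate _ R₄)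
    = H₅ , s₁ ◅◅ s₂ ◅◅ s₃ ◅◅ s₄ ◅◅ s₅ , rotate _ R₅

  skeleton : List (Branch n)
  skeleton = wBranches [] [] [] [] []

  skeleton-edge⇒W : ∀ {a b} → BranchEdge skeleton a b → ∃₂ λ i j → W i j ≡ true × a ≡ f i × b ≡ f j
  skeleton-edge⇒W (here here)                                  = _ , _ , refl , refl , refl
  skeleton-edge⇒W (there (here here))                          = _ , _ , refl , refl , refl
  skeleton-edge⇒W (there (there (here here)))                  = _ , _ , refl , refl , refl
  skeleton-edge⇒W (there (there (there (here here))))          = _ , _ , refl , refl , refl
  skeleton-edge⇒W (there (there (there (there (here here)))))  = _ , _ , refl , refl , refl
  skeleton-edge⇒W (here (there (there ())))
  skeleton-edge⇒W (there (here (there (there ()))))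
  skeleton-edge⇒W (there (there (here (there (there ())))))
  skeleton-edge⇒W (there (there (there (here (there (there ()))))))
  skeleton-edge⇒W (there (there (there (there (here (there (there ())))))))

  W⇒skeleton-edge : ∀ i j → W i j ≡ true → BranchEdge skeleton (f i) (f j)
  W⇒skeleton-edge zero             (suc zero)                   _ = here here
  W⇒skeleton-edge zero             (suc (suc zero))             _ = there (here here)
  W⇒skeleton-edge (suc zero)       (suc (suc zero))             _ = there (there (here here))
  W⇒skeleton-edge (suc zero)       (suc (suc (suc zero)))       _ = there (there (there (here here)))
  W⇒skeleton-edge (suc (suc zero)) (suc (suc (suc zero)))       _ = there (there (there (there (here here))))
  W⇒skeleton-edge zero                   zero                   ()
  W⇒skeleton-edge zero                   (suc (suc (suc zero))) ()
  W⇒skeleton-edge (suc zero)             zero                   ()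
  W⇒skeleton-edge (suc zero)             (suc zero)             ()
  W⇒skeleton-edge (suc (suc zero))       zero                   ()
  W⇒skeleton-edge (suc (suc zero))       (suc zero)             ()
  W⇒skeleton-edge (suc (suc zero))       (suc (suc zero))       ()
  W⇒skeleton-edge (suc (suc (suc zero))) _                      ()

  -- Duplicate-free corners make f injective.
  corners-at : ∀ i → corners at toℕ i ≡ just (f i)
  corners-at zero                   = refl
  corners-at (suc zero)             = refl
  corners-at (suc (suc zero))       = refl
  corners-at (suc (suc (suc zero))) = refl

  skeleton⇒IsoW : ∀ {H} → Realises H skeleton → IsoW H
  skeleton⇒IsoW {H} R = f , f-injective , (λ i → ⊆vtx (f i) (corner∈ i)) , onto , edges , ends
    where
    open Realises R
    f-injective : ∀ {i j} → f i ≡ f j → i ≡ j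
    f-injective {i} {j} fi≡fj =
      toℕ-injective (at-injective unique (corners-at i) (trans (corners-at j) (cong just (sym fi≡fj))))
    onto : ∀ v → vtx H v ≡ true → ∃ λ i → f i ≡ v
    onto v h with vtx⊆ v h
    ... | here refl                         = _ , refl
    ... | there (here refl)                 = _ , refl
    ... | there (there (here refl))         = _ , refl
    ... | there (there (there (here refl))) = _ , refl
    edges : ∀ i j → edge H (f i) (f j) ≡ W i j
    edges i j = bool-≡ forward (λ w → ⊆edge (f i) (f j) (W⇒skeleton-edge i j w))
      where
      forward : edge H (f i) (f j) ≡ true → W i j ≡ true
      forward h with i′ , j′ , w , fi≡ , fj≡ ← skeleton-edge⇒W (edge⊆ (f i) (f j) h)
                with refl ← f-injective fi≡ | refl ← f-injective fj≡ = w
    ends : ∀ a b → edge H a b ≡ true → (∃ λ i → f i ≡ a) × (∃ λ j → f j ≡ b)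
    ends a b h with i , j , _ , refl , refl ← skeleton-edge⇒W (edge⊆ a b h) = (i , refl) , (j , refl)

  module Prune (E : EdgeRel n) (bs : List (Branch n)) (bs⊆E : ∀ a b → BranchEdge bs a b → E a b ≡ true) where

    record PruningEdges (H : PGraph n) (todo : List (Fin n × Fin n)) : Set where
      field
        allVtx : ∀ v → vtx H v ≡ true
        edge⊆  : ∀ a b → edge H a b ≡ true → BranchEdge bs a b ⊎ (a , b) ∈ todo
        ⊆edge  : ∀ a b → BranchEdge bs a b → edge H a b ≡ true

    skip-edge : ∀ {H a₀ b₀ todo} → BranchEdge bs a₀ b₀ ⊎ edge H a₀ b₀ ≡ false →
                PruningEdges H ((a₀ , b₀) ∷ todo) → PruningEdges H todo
    skip-edge {H} {a₀} {b₀} {todo} keep P = record { allVtx = allVtx ; edge⊆ = edge⊆′ ; ⊆edge = ⊆edge }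
      where
      open PruningEdges P
      edge⊆′ : ∀ a b → edge H a b ≡ true → BranchEdge bs a b ⊎ (a , b) ∈ todo
      edge⊆′ a b h with edge⊆ a b h
      ... | inj₁ c               = inj₁ c
      ... | inj₂ (there ab∈todo) = inj₂ ab∈todo
      ... | inj₂ (here refl)     = inj₁ (unless-absent keep h)

    drop-edge : ∀ {H a₀ b₀ todo} → ¬ BranchEdge bs a₀ b₀ →
                PruningEdges H ((a₀ , b₀) ∷ todo) → PruningEdges (pg (vtx H) (removeEdge (edge H) a₀ b₀)) todo
    drop-edge {H} {a₀} {b₀} {todo} ¬c P = record { allVtx = allVtx ; edge⊆ = edge⊆′ ; ⊆edge = ⊆edge′ }
      where
      open PruningEdges P
      edge⊆′ : ∀ a b → removeEdge (edge H) a₀ b₀ a b ≡ true → BranchEdge bs a b ⊎ (a , b) ∈ todo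
      edge⊆′ a b h with h′ , ¬ab₀ ← removeEdge-true (edge H) a₀ b₀ a b h with edge⊆ a b h′
      ... | inj₁ c               = inj₁ c
      ... | inj₂ (here refl)     = ⊥-elim (¬ab₀ (refl , refl))
      ... | inj₂ (there ab∈todo) = inj₂ ab∈todo
      ⊆edge′ : ∀ a b → BranchEdge bs a b → removeEdge (edge H) a₀ b₀ a b ≡ true
      ⊆edge′ a b c = trans (removeEdge-other (edge H) a₀ b₀ a b (λ { (refl , refl) → ¬c c })) (⊆edge a b c)

    prune-edges : ∀ todo {H} → PruningEdges H todo → ∃ λ H′ → Star Step H H′ × PruningEdges H′ []
    prune-edges []                  P = _ , ε , P
    prune-edges ((a₀ , b₀) ∷ todo) {H} P with BranchEdge? bs a₀ b₀ | edge H a₀ b₀ in e₀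
    ... | yes c | _     = prune-edges todo (skip-edge (inj₁ c) P)
    ... | no ¬c | false = prune-edges todo (skip-edge (inj₂ e₀) P)
    ... | no ¬c | true with H′ , s , P′ ← prune-edges todo (drop-edge ¬c P) = H′ , delEdge H a₀ b₀ e₀ ◅ s , P′

    record PruningVertices (H : PGraph n) (todo : List (Fin n)) : Set where
      field
        edge⊆ : ∀ a b → edge H a b ≡ true → BranchEdge bs a b
        ⊆edge : ∀ a b → BranchEdge bs a b → edge H a b ≡ true
        vtx⊆  : ∀ v → vtx H v ≡ true → v ∈ support bs ⊎ v ∈ todo
        ⊆vtx  : ∀ v → v ∈ support bs → vtx H v ≡ true

    ∈support? : ∀ v → Dec (v ∈ support bs)
    ∈support? v = any? (v ≟_) (support bs)

    skip-vertex : ∀ {H v₀ todo} → v₀ ∈ support bs ⊎ vtx H v₀ ≡ false →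
                  PruningVertices H (v₀ ∷ todo) → PruningVertices H todo
    skip-vertex {H} {v₀} {todo} keep P = record { edge⊆ = edge⊆ ; ⊆edge = ⊆edge ; vtx⊆ = vtx⊆′ ; ⊆vtx = ⊆vtx }
      where
      open PruningVertices P
      vtx⊆′ : ∀ v → vtx H v ≡ true → v ∈ support bs ⊎ v ∈ todo
      vtx⊆′ v h with vtx⊆ v h
      ... | inj₁ k              = inj₁ k
      ... | inj₂ (there v∈todo) = inj₂ v∈todo
      ... | inj₂ (here refl)    = inj₁ (unless-absent keep h)

    -- A vertex outside the support is isolated, since every edge is a branch edge.
    isolated-out : ∀ {H todo v₀} → PruningVertices H todo → v₀ ∉ support bs → ∀ w → edge H v₀ w ≡ false
    isolated-out P ¬k w = ¬-not (λ h → ¬k (proj₁ (branchEdge-ends (PruningVertices.edge⊆ P _ w h))))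

    isolated-in : ∀ {H todo v₀} → PruningVertices H todo → v₀ ∉ support bs → ∀ w → edge H w v₀ ≡ false
    isolated-in P ¬k w = ¬-not (λ h → ¬k (proj₂ (branchEdge-ends (PruningVertices.edge⊆ P w _ h))))

    drop-vertex : ∀ {H v₀ todo} → v₀ ∉ support bs →
                  PruningVertices H (v₀ ∷ todo) → PruningVertices (pg (deleteVtx (vtx H) v₀) (edge H)) todo
    drop-vertex {H} {v₀} {todo} ¬k P = record { edge⊆ = edge⊆ ; ⊆edge = ⊆edge ; vtx⊆ = vtx⊆′ ; ⊆vtx = ⊆vtx′ }
      where
      open PruningVertices P
      vtx⊆′ : ∀ v → deleteVtx (vtx H) v₀ v ≡ true → v ∈ support bs ⊎ v ∈ todo
      vtx⊆′ v h with v≢v₀ , h′ ← deleteVtx-true (vtx H) v₀ v h with vtx⊆ v h′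
      ... | inj₁ k              = inj₁ k
      ... | inj₂ (here refl)    = ⊥-elim (v≢v₀ refl)
      ... | inj₂ (there v∈todo) = inj₂ v∈todo
      ⊆vtx′ : ∀ v → v ∈ support bs → deleteVtx (vtx H) v₀ v ≡ true
      ⊆vtx′ v k = trans (deleteVtx-other (vtx H) v₀ v (λ { refl → ¬k k })) (⊆vtx v k)

    prune-vertices : ∀ todo {H} → PruningVertices H todo → ∃ λ H′ → Star Step H H′ × PruningVertices H′ []
    prune-vertices []          P = _ , ε , P
    prune-vertices (v₀ ∷ todo) {H} P with ∈support? v₀ | vtx H v₀ in e₀
    ... | yes k | _     = prune-vertices todo (skip-vertex (inj₁ k) P)
    ... | no ¬k | false = prune-vertices todo (skip-vertex (inj₂ e₀) P)
    ... | no ¬k | true with H′ , s , P′ ← prune-vertices todo (drop-vertex ¬k P) =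
      H′ , delVtx H v₀ e₀ (isolated-out P ¬k) (isolated-in P ¬k) ◅ s , P′

    prune : Unique (support bs) → ∃ λ H → Star Step (full E) H × Realises H bs
    prune unique
      with H₁ , s₁ , P₁ ← prune-edges (cartesianProduct (allFin n) (allFin n)) {full E}
             (record { allVtx = λ _ → refl
                     ; edge⊆  = λ a b _ → inj₂ (∈-cartesianProduct⁺ (∈-allFin a) (∈-allFin b))
                     ; ⊆edge  = bs⊆E })
      with H₂ , s₂ , P₂ ← prune-vertices (allFin n) {H₁}
             (record { edge⊆ = λ a b h → [ id , (λ ()) ]′ (PruningEdges.edge⊆ P₁ a b h)
                     ; ⊆edge = PruningEdges.⊆edge P₁
                     ; vtx⊆  = λ v _ → inj₂ (∈-allFin v)
                     ; ⊆vtx  = λ v _ → PruningEdges.allVtx P₁ v })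
      = H₂ , s₁ ◅◅ s₂ , record
          { unique = unique
          ; vtx⊆   = λ v h → [ id , (λ ()) ]′ (PruningVertices.vtx⊆ P₂ v h)
          ; ⊆vtx   = PruningVertices.⊆vtx P₂
          ; edge⊆  = PruningVertices.edge⊆ P₂
          ; ⊆edge  = PruningVertices.⊆edge P₂ }

record WSubdivision {n : ℕ} (E : EdgeRel n) : Set where
  field
    corner              : Fin 4 → Fin n
    m₀₁ m₀₂ m₁₂ m₁₃ m₂₃ : List (Fin n)
    unique              : Unique (Realisation.support corner (Realisation.wBranches corner m₀₁ m₀₂ m₁₂ m₁₃ m₂₃))
    paths               : All (λ β → Linked (Edge E) (Realisation.branchPath corner β))
                              (Realisation.wBranches corner m₀₁ m₀₂ m₁₂ m₁₃ m₂₃)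

module _ {n : ℕ} {E : EdgeRel n} (S : WSubdivision E) where
  open WSubdivision S
  open Realisation corner

  branches⊆E : ∀ a b → BranchEdge (wBranches m₀₁ m₀₂ m₁₂ m₁₃ m₂₃) a b → E a b ≡ true
  branches⊆E a b = on-paths paths
    where
    on-paths : ∀ {βs} → All (λ β → Linked (Edge E) (branchPath β)) βs → BranchEdge βs a b → E a b ≡ true
    on-paths (l ∷ _)  (here c)  = linked-pair l c
    on-paths (_ ∷ ls) (there c) = on-paths ls c

  subdivision⇒homeomorphic : ContainsHomeoW E
  subdivision⇒homeomorphic
    with H₁ , s₁ , R₁ ← Prune.prune E (wBranches m₀₁ m₀₂ m₁₂ m₁₃ m₂₃) branches⊆E unique
    with H₂ , s₂ , R₂ ← smooth-all m₀₁ m₀₂ m₁₂ m₁₃ m₂₃ R₁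
    = H₂ , s₁ ◅◅ s₂ , skeleton⇒IsoW R₂

module Crossing {A : Set} (_≟_ : DecidableEquality A) (s t : A) (midp midq : List A)
                (up : Unique (s ∷ midp ++ [ t ])) (uq : Unique (s ∷ midq ++ [ t ])) where

  p q : List A
  p = s ∷ midp ++ [ t ]
  q = s ∷ midq ++ [ t ]

  endp endq : ℕ
  endp = suc (length midp)
  endq = suc (length midq)

  record Meet (k l : ℕ) : Set where
    constructor meet
    field
      {vertex} : A
      atp      : p at k ≡ just vertex
      atq      : q at l ≡ just vertex

  Meet? : ∀ k l → Dec (Meet k l)
  Meet? k l with p at k in ek | q at l in el
  ... | nothing | _       = no λ { (meet e _) → case trans (sym ek) e of λ () }
  ... | just v  | nothing = no λ { (meet _ e) → case trans (sym el) e of λ () }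
  ... | just v  | just w with v ≟ w
  ...   | yes refl = yes (meet ek el)
  ...   | no v≢w   = no λ { (meet e e′) →
                       v≢w (just-injective (trans (trans (sym ek) e) (trans (sym e′) el))) }

  meet-<p : ∀ {k l} → Meet k l → k < length p
  meet-<p (meet e _) = at-< {xs = p} e

  meet-<q : ∀ {k l} → Meet k l → l < length q
  meet-<q (meet _ e) = at-< {xs = q} e

  -- Since p and q are duplicate-free, each position determines its partner.
  meet-functionalʳ : ∀ {k l l′} → Meet k l → Meet k l′ → l ≡ l′
  meet-functionalʳ (meet e₁ e₂) (meet e₁′ e₂′) with refl ← trans (sym e₁) e₁′ = at-injective uq e₂ e₂′

  meet-functionalˡ : ∀ {k k′ l} → Meet k l → Meet k′ l → k ≡ k′
  meet-functionalˡ (meet e₁ e₂) (meet e₁′ e₂′) with refl ← trans (sym e₂) e₂′ = at-injective up e₁ e₁′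

  meet-start : Meet 0 0
  meet-start = meet refl refl

  meet-end : Meet endp endq
  meet-end = meet (at-snoc midp) (at-snoc midq)

  length-p : length p ≡ suc endp
  length-p = cong suc (length-snoc midp)

  length-q : length q ≡ suc endq
  length-q = cong suc (length-snoc midq)

  meet-≤endp : ∀ {k l} → Meet k l → k ≤ endp
  meet-≤endp {k} m with s≤s k≤ ← subst (k <_) length-p (meet-<p m) = k≤

  meet-≤endq : ∀ {k l} → Meet k l → l ≤ endq
  meet-≤endq {l = l} m with s≤s l≤ ← subst (l <_) length-q (meet-<q m) = l≤

  -- The first and last meeting points are (0 , 0) and (endp , endq), so no other meeting
  -- point has a zero or a final position in just one of the lists.
  meet-positiveˡ : ∀ {k l} → Meet k l → 0 < l → 0 < k
  meet-positiveˡ {zero}  m 0<l with refl ← meet-functionalʳ meet-start m = 0<l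
  meet-positiveˡ {suc k} _ _   = s≤s z≤n

  meet-positiveʳ : ∀ {k l} → Meet k l → 0 < k → 0 < l
  meet-positiveʳ {l = zero}  m 0<k with refl ← meet-functionalˡ meet-start m = 0<k
  meet-positiveʳ {l = suc l} _ _   = s≤s z≤n

  meet-before-endˡ : ∀ {k l} → Meet k l → l < endq → k < endp
  meet-before-endˡ m l<end =
    ≤∧≢⇒< (meet-≤endp m) λ { refl → <-irrefl (sym (meet-functionalʳ meet-end m)) l<end }

  meet-before-endʳ : ∀ {k l} → Meet k l → k < endp → l < endq
  meet-before-endʳ m k<end =
    ≤∧≢⇒< (meet-≤endq m) λ { refl → <-irrefl (sym (meet-functionalˡ meet-end m)) k<end }

  endp<length : endp < length p
  endp<length = subst (endp <_) (sym length-p) ≤-refl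

  endq<length : endq < length q
  endq<length = subst (endq <_) (sym length-q) ≤-refl

  record Frame : Set where
    field
      {pa qa px qx py qy pd qd} : ℕ
      meetA : Meet pa qa
      meetX : Meet px qx
      meetY : Meet py qy
      meetD : Meet pd qd
      pa<px : pa < px
      px<py : px < py
      py<pd : py < pd
      qa<qy : qa < qy
      qy<qx : qy < qx
      qx<qd : qx < qd
      low-gap  : ∀ {k l} → pa < k → l < qy → ¬ Meet k l
      high-gap : ∀ {k l} → k < pd → qx < l → ¬ Meet k l

  Crossed : ℕ → Set
  Crossed l = ∃ λ k → k < length p × (Meet k l ×
                ∃ λ k′ → k′ < k × ∃ λ l′ → l′ < length q × (l < l′ × Meet k′ l′))

  Crossed? : ∀ l → Dec (Crossed l)
  Crossed? l = anyUpTo? (λ k → Meet? k l ×-dec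
                 anyUpTo? (λ k′ → anyUpTo? (λ l′ → (l <? l′) ×-dec Meet? k′ l′) (length q)) k) (length p)

  -- If p and q visit two vertices in opposite orders, the extremal choices
  --   y : the crossed meeting point earliest on q,
  --   x : the meeting point before y on p that is latest on q,
  --   a : the meeting point before x on p that is latest on p among those before y on q,
  --   d : the meeting point after y on p and after x on q that is earliest on p,
  -- form a frame.
  frame : ∀ {k₁ k₂ l₁ l₂} → k₁ < k₂ → l₂ < l₁ → Meet k₁ l₁ → Meet k₂ l₂ → Frame
  frame k₁<k₂ l₂<l₁ m₁ m₂
    with qy , _ , (py , _ , (meetY , px₀ , px₀<py , qx₀ , qx₀<q , qy<qx₀ , meetX₀)) , first-crossed
           ← least Crossed? (length q)
               (_ , meet-<q m₂ , _ , meet-<p m₂ , (m₂ , _ , k₁<k₂ , _ , meet-<q m₁ , l₂<l₁ , m₁))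
    with qx , _ , (px , px<py , meetX) , last-before-y
           ← greatest (λ l → anyUpTo? (λ k → Meet? k l) py) (length q) (qx₀ , qx₀<q , px₀ , px₀<py , meetX₀)
    with qy<qx ← <-≤-trans qy<qx₀ (below-greatest last-before-y qx₀<q (px₀ , px₀<py , meetX₀))
    with pa , pa<px , (qa , qa<qy , meetA) , last-before-x
           ← greatest (λ k → anyUpTo? (λ l → Meet? k l) qy) px
               (0 , meet-positiveˡ meetX (<-≤-trans (s≤s z≤n) qy<qx) ,
                0 , meet-positiveʳ meetY (<-≤-trans (s≤s z≤n) px<py) , meet-start)
    with pd , _ , (py<pd , qd , _ , qx<qd , meetD) , first-after
           ← least (λ k → (py <? k) ×-dec anyUpTo? (λ l → (qx <? l) ×-dec Meet? k l) (length q)) (length p)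
               (endp , endp<length ,
                meet-before-endˡ meetY (<-≤-trans qy<qx (meet-≤endq meetX)) ,
                endq , endq<length , meet-before-endʳ meetX (<-≤-trans px<py (meet-≤endp meetY)) , meet-end)
    = record
        { meetA = meetA ; meetX = meetX ; meetY = meetY ; meetD = meetD
        ; pa<px = pa<px ; px<py = px<py ; py<pd = py<pd ; qa<qy = qa<qy ; qy<qx = qy<qx ; qx<qd = qx<qd
        ; low-gap = low-gap ; high-gap = high-gap }
    where
    low-gap : ∀ {k l} → pa < k → l < qy → ¬ Meet k l
    low-gap {k} {l} pa<k l<qy m with <-cmp k px
    ... | tri< k<px _ _ = last-before-x k pa<k k<px (l , l<qy , m)
    ... | tri≈ _ refl _ = <-asym l<qy (subst (qy <_) (meet-functionalʳ meetX m) qy<qx)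
    ... | tri> _ _ px<k = first-crossed l l<qy
                            (k , meet-<p m , (m , px , px<k , qx , meet-<q meetX , <-trans l<qy qy<qx , meetX))
    high-gap : ∀ {k l} → k < pd → qx < l → ¬ Meet k l
    high-gap {k} {l} k<pd qx<l m with <-cmp k py
    ... | tri< k<py _ _ = last-before-y l qx<l (meet-<q m) (k , k<py , m)
    ... | tri≈ _ refl _ = <-asym qx<l (subst (_< qx) (meet-functionalʳ meetY m) qy<qx)
    ... | tri> _ _ py<k = first-after k k<pd (py<k , l , meet-<q m , qx<l , m)

  module FrameParts (F : Frame) where
    open Frame F

    a x y d : A
    a = Meet.vertex meetA
    x = Meet.vertex meetX
    y = Meet.vertex meetY
    d = Meet.vertex meetD

    m₀₁ m₀₂ m₁₂ m₁₃ m₂₃ : List A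
    m₀₁ = between p pa px
    m₀₂ = between q qa qy
    m₁₂ = between p px py
    m₁₃ = between q qx qd
    m₂₃ = between p py pd

    p-section : span p pa (suc pd) ≡ a ∷ m₀₁ ++ x ∷ m₁₂ ++ y ∷ m₂₃ ++ [ d ]
    p-section = begin
      span p pa (suc pd)
        ≡⟨ span-split p (<⇒≤ pa<px) (<⇒≤suc (<-trans px<py py<pd)) ⟩
      span p pa px ++ span p px (suc pd)
        ≡⟨ cong (span p pa px ++_) (span-split p (<⇒≤ px<py) (<⇒≤suc py<pd)) ⟩
      span p pa px ++ span p px py ++ span p py (suc pd)
        ≡⟨ cong₂ _++_ (span-head p (Meet.atp meetA) pa<px)
             (cong₂ _++_ (span-head p (Meet.atp meetX) px<py)
               (span-closed p (Meet.atp meetY) (Meet.atp meetD) py<pd)) ⟩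
      a ∷ m₀₁ ++ x ∷ m₁₂ ++ y ∷ m₂₃ ++ [ d ]
        ∎
      where
      open ≡-Reasoning
      <⇒≤suc : ∀ {i j} → i < j → i ≤ suc j
      <⇒≤suc i<j = m≤n⇒m≤1+n (<⇒≤ i<j)

    off-p-section : ∀ {k l} → pa ≤ k → k ≤ pd → (qa < l × l < qy) ⊎ (qx < l × l < qd) → ¬ Meet k l
    off-p-section pa≤k _ (inj₁ (qa<l , l<qy)) m with m≤n⇒m<n∨m≡n pa≤k
    ... | inj₁ pa<k = low-gap pa<k l<qy m
    ... | inj₂ refl = <-irrefl (meet-functionalʳ meetA m) qa<l
    off-p-section _ k≤pd (inj₂ (qx<l , l<qd)) m with m≤n⇒m<n∨m≡n k≤pd
    ... | inj₁ k<pd = high-gap k<pd qx<l m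
    ... | inj₂ refl = <-irrefl (sym (meet-functionalʳ meetD m)) l<qd

    q-sections-unique : Unique (m₀₂ ++ m₁₃)
    q-sections-unique = Unique.++⁺ (span-unique (suc qa) qy uq) (span-unique (suc qx) qd uq) disjoint
      where
      disjoint : ∀ {v} → ¬ (v ∈ m₀₂ × v ∈ m₁₃)
      disjoint (v∈₁ , v∈₂)
        with l₁ , _ , l₁<qy , e₁ ← ∈-span q {suc qa} {qy} v∈₁
        with l₂ , qx<l₂ , _ , e₂ ← ∈-span q {suc qx} {qd} v∈₂ =
        <-irrefl (at-injective uq e₁ e₂) (<-trans l₁<qy (<-trans qy<qx qx<l₂))

    sections-unique : Unique (span p pa (suc pd) ++ m₀₂ ++ m₁₃)
    sections-unique = Unique.++⁺ (span-unique pa (suc pd) up) q-sections-unique disjoint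
      where
      disjoint : ∀ {v} → ¬ (v ∈ span p pa (suc pd) × v ∈ m₀₂ ++ m₁₃)
      disjoint (v∈p , v∈q) with k , pa≤k , s≤s k≤pd , ek ← ∈-span p {pa} {suc pd} v∈p | ∈-++⁻ m₀₂ v∈q
      ... | inj₁ v∈₀₂ with l , qa<l , l<qy , el ← ∈-span q {suc qa} {qy} v∈₀₂ =
        off-p-section pa≤k k≤pd (inj₁ (qa<l , l<qy)) (meet ek el)
      ... | inj₂ v∈₁₃ with l , qx<l , l<qd , el ← ∈-span q {suc qx} {qd} v∈₁₃ =
        off-p-section pa≤k k≤pd (inj₂ (qx<l , l<qd)) (meet ek el)

    frame-unique : Unique (a ∷ x ∷ y ∷ d ∷ m₀₁ ++ m₀₂ ++ m₁₂ ++ m₁₃ ++ m₂₃ ++ [])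
    frame-unique = PermutationProperties.Unique-resp-↭ (setoid A) (↭⇒↭ₛ regroup)
                     (subst (λ P → Unique (P ++ m₀₂ ++ m₁₃)) p-section sections-unique)
      where
      open CommutativeMonoidSolver (++-commutativeMonoid {A = A}) using (solve; _⊜_; _⊕_) renaming (id to ∅)
      regroup : (a ∷ m₀₁ ++ x ∷ m₁₂ ++ y ∷ m₂₃ ++ [ d ]) ++ m₀₂ ++ m₁₃ ↭
                a ∷ x ∷ y ∷ d ∷ m₀₁ ++ m₀₂ ++ m₁₂ ++ m₁₃ ++ m₂₃ ++ []
      regroup = solve 9 (λ a x y d m₀₁ m₀₂ m₁₂ m₁₃ m₂₃ →
                  (a ⊕ (m₀₁ ⊕ (x ⊕ (m₁₂ ⊕ (y ⊕ (m₂₃ ⊕ d)))))) ⊕ (m₀₂ ⊕ m₁₃) ⊜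
                  a ⊕ (x ⊕ (y ⊕ (d ⊕ (m₀₁ ⊕ (m₀₂ ⊕ (m₁₂ ⊕ (m₁₃ ⊕ (m₂₃ ⊕ ∅)))))))))
                  ↭-refl [ a ] [ x ] [ y ] [ d ] m₀₁ m₀₂ m₁₂ m₁₃ m₂₃

opposite-orders⇒W : ∀ {n} {E : EdgeRel n} {s t p q u w} → IsPathA E s t p → IsPathA E s t q →
                    Before p u w → Before q w u → ContainsHomeoW E
opposite-orders⇒W {n} {E} {s} {t} (midp , refl , lp , up) (midq , refl , lq , uq)
                  (k₁ , k₂ , k₁<k₂ , pu , pw) (l₂ , l₁ , l₂<l₁ , qw , qu) =
  subdivision⇒homeomorphic (record
    { corner = corner ; m₀₁ = m₀₁ ; m₀₂ = m₀₂ ; m₁₂ = m₁₂ ; m₁₃ = m₁₃ ; m₂₃ = m₂₃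
    ; unique = frame-unique
    ; paths  = linked-between lp (Meet.atp meetA) (Meet.atp meetX) pa<px
             ∷ linked-between lq (Meet.atq meetA) (Meet.atq meetY) qa<qy
             ∷ linked-between lp (Meet.atp meetX) (Meet.atp meetY) px<py
             ∷ linked-between lq (Meet.atq meetX) (Meet.atq meetD) qx<qd
             ∷ linked-between lp (Meet.atp meetY) (Meet.atp meetD) py<pd
             ∷ [] })
  where
  open Crossing _≟_ s t midp midq up uq
  F : Frame
  F = frame k₁<k₂ l₂<l₁ (meet pu qu) (meet pw qw)
  open Frame F
  open FrameParts F
  corner : Fin 4 → Fin n
  corner zero                   = a
  corner (suc zero)             = x
  corner (suc (suc zero))       = y
  corner (suc (suc (suc zero))) = d

module _ {A : Set} {U R : A → A → Set} (U? : ∀ a b → Dec (U a b)) (U⇒R : ∀ {a b} → U a b → R a b)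
         (R-trans : ∀ {a b c} → R a b → R b c → R a c) where

  gap-or-chain : ∀ x ys e → (∃₂ λ a b → ConsecPair a b (x ∷ ys ++ [ e ]) × ¬ U a b) ⊎ R x e
  gap-or-chain x []       e with U? x e
  ... | yes u = inj₂ (U⇒R u)
  ... | no ¬u = inj₁ (x , e , here , ¬u)
  gap-or-chain x (y ∷ ys) e with U? x y
  ... | no ¬u = inj₁ (x , y , here , ¬u)
  ... | yes u with gap-or-chain y ys e
  ...   | inj₁ (a , b , ab∈ , ¬uab) = inj₁ (a , b , there ab∈ , ¬uab)
  ...   | inj₂ r                    = inj₂ (R-trans (U⇒R u) r)

module Precedence {n : ℕ} (E : EdgeRel n) (s t : Fin n) where

  _≺_ : Fin n → Fin n → Set
  u ≺ v = ∃ λ r → IsPathA E s t r × Before r u v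

  ≺-irreflexive : ∀ {u} → ¬ u ≺ u
  ≺-irreflexive (r , (_ , _ , _ , ur) , i , j , i<j , e , e′) = <-irrefl (at-injective ur e e′) i<j

  ≺-asymmetric : ¬ ContainsHomeoW E → ∀ {u v} → u ≺ v → v ≺ u → ⊥
  ≺-asymmetric noW (r , rP , u<v) (r′ , rP′ , v<u) = noW (opposite-orders⇒W rP rP′ u<v v<u)

  splice : ∀ {P Q i j v} → IsPathA E s t P → IsPathA E s t Q → P at suc j ≡ just v → Q at i ≡ just v →
           (∀ {z} → Before P z v → Before Q v z → ⊥) → IsPathA E s t (take (suc j) P ++ drop i Q)
  splice {i = i} {j} {v} (midp , refl , lp , up) (midq , refl , lq , uq) pv qv no-cross =
    take j (midp ++ [ t ]) ++ drop i (s ∷ midq) , shape , linked , unique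
    where
    P = s ∷ midp ++ [ t ]
    Q = s ∷ midq ++ [ t ]
    i≤ : i ≤ length (s ∷ midq)
    i≤ with s≤s i≤′ ← subst (i <_) (cong suc (length-snoc midq)) (at-< {xs = Q} qv) = i≤′
    shape : take (suc j) P ++ drop i Q ≡ s ∷ (take j (midp ++ [ t ]) ++ drop i (s ∷ midq)) ++ [ t ]
    shape = trans (cong (λ D → s ∷ take j (midp ++ [ t ]) ++ D) (drop-++ (s ∷ midq) i i≤))
                  (cong (s ∷_) (sym (++-assoc (take j (midp ++ [ t ])) (drop i (s ∷ midq)) [ t ])))
    linked : Linked (Edge E) (take (suc j) P ++ drop i Q)
    linked = subst (λ D → Linked (Edge E) (take (suc j) P ++ D)) (sym (drop-at Q i qv))
               (linked-join {j = suc j} lp pv (subst (Linked (Edge E)) (drop-at Q i qv) (linked-drop i lq)))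
    unique : Unique (take (suc j) P ++ drop i Q)
    unique = Unique.++⁺ (Unique.take⁺ (suc j) up) (Unique.drop⁺ i uq) disjoint
      where
      disjoint : ∀ {z} → ¬ (z ∈ take (suc j) P × z ∈ drop i Q)
      disjoint (z∈P , z∈Q)
        with k , _ , k<j , pz ← ∈-span P {0} {suc j} z∈P
        with l , i≤l , qz ← ∈-drop Q z∈Q
        with m≤n⇒m<n∨m≡n i≤l
      ... | inj₁ i<l  = no-cross (k , suc j , k<j , pz , pv) (i , l , i<l , qv , qz)
      ... | inj₂ refl with refl ← trans (sym qz) qv = <-irrefl (at-injective up pz pv) k<j

  -- Splicing a path witnessing u ≺ v with one witnessing v ≺ w at v; asymmetry rules out
  -- a vertex before v on the first and after v on the second.
  ≺-transitive : ¬ ContainsHomeoW E → ∀ {u v w} → u ≺ v → v ≺ w → u ≺ w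
  ≺-transitive noW {u} {v} {w} (P , PP , i₁ , suc j₁ , i₁<j₁ , pu , pv)
                               (Q , QP , i₂ , j₂ , i₂<j₂ , qv , qw) =
    spliced ,
    splice PP QP pv qv (λ z<v v<z → ≺-asymmetric noW (P , PP , z<v) (Q , QP , v<z)) ,
    i₁ , suc j₁ + (j₂ ∸ i₂) , <-≤-trans i₁<j₁ (m≤m+n _ _) , at-u , at-w
    where
    prefix spliced : List (Fin n)
    prefix  = take (suc j₁) P
    spliced = prefix ++ drop i₂ Q
    length-prefix : length prefix ≡ suc j₁
    length-prefix = length-take P (<⇒≤ (at-< {xs = P} pv))
    at-u : spliced at i₁ ≡ just u
    at-u = trans (at-++ˡ prefix i₁ (subst (i₁ <_) (sym length-prefix) i₁<j₁)) (trans (at-take P i₁<j₁) pu)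
    at-w : spliced at (suc j₁ + (j₂ ∸ i₂)) ≡ just w
    at-w = begin
      spliced at (suc j₁ + (j₂ ∸ i₂))         ≡⟨ cong (λ m → spliced at (m + (j₂ ∸ i₂))) (sym length-prefix) ⟩
      spliced at (length prefix + (j₂ ∸ i₂))  ≡⟨ at-++ʳ prefix (j₂ ∸ i₂) ⟩
      drop i₂ Q at (j₂ ∸ i₂)                  ≡⟨ at-drop Q i₂ (j₂ ∸ i₂) ⟩
      Q at (i₂ + (j₂ ∸ i₂))                   ≡⟨ cong (Q at_) (m+[n∸m]≡n (<⇒≤ i₂<j₂)) ⟩
      Q at j₂                                 ≡⟨ qw ⟩
      just w                                  ∎
      where open ≡-Reasoning

  Used : Fin n → Fin n → Set
  Used a b = ∃ λ r → IsPathA E s t r × ConsecPair a b r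

  used⇒≺ : ∀ {a b} → Used a b → a ≺ b
  used⇒≺ (r , rP , ab∈r) = r , rP , cp-positions ab∈r

  unused⇒removable : ∀ {a b} → ¬ Used a b → SamePathA (removeEdge E a b) E s t
  unused⇒removable {a} {b} unused r = to , from
    where
    to : IsPathA (removeEdge E a b) s t r → IsPathA E s t r
    to (mid , shape , l , u) =
      mid , shape , linked-relabel l (λ {x} {y} _ h → proj₁ (removeEdge-true E a b x y h)) , u
    from : IsPathA E s t r → IsPathA (removeEdge E a b) s t r
    from rP@(mid , shape , l , u) = mid , shape , linked-relabel l kept , u
      where
      kept : ∀ {x y} → ConsecPair x y r → Edge E x y → Edge (removeEdge E a b) x y
      kept {x} {y} xy∈r h = trans (removeEdge-other E a b x y (λ { (refl , refl) → unused (r , rP , xy∈r) })) h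

  -- Used is decidable: acyclic paths have at most n vertices, so it suffices to search all
  -- lists of length at most n.
  shape? : ∀ (r : List (Fin n)) → Dec (Σ (List (Fin n)) λ mid → r ≡ s ∷ mid ++ [ t ])
  shape? []      = no λ { (_ , ()) }
  shape? (x ∷ r) with x ≟ s | initLast r
  ... | no x≢s   | _          = no λ { (_ , refl) → x≢s refl }
  ... | yes refl | []         =
    no λ { (mid , e) → case ++-conicalʳ mid [ t ] (sym (∷-injectiveʳ e)) of λ () }
  ... | yes refl | mid ∷ʳ′ y with y ≟ t
  ...   | yes refl = yes (mid , refl)
  ...   | no y≢t   = no λ { (mid′ , e) → y≢t (∷ʳ-injectiveʳ mid mid′ (∷-injectiveʳ e)) }

  IsPathA? : ∀ (r : List (Fin n)) → Dec (IsPathA E s t r)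
  IsPathA? r with shape? r | linked? (λ a b → E a b Bool.≟ true) r | allPairs? (λ x y → ¬? (x ≟ y)) r
  ... | yes (mid , e) | yes l | yes u = yes (mid , e , l , u)
  ... | no ¬shape     | _     | _     = no λ { (mid , e , _ , _) → ¬shape (mid , e) }
  ... | yes _         | no ¬l | _     = no λ { (_ , _ , l , _) → ¬l l }
  ... | yes _         | yes _ | no ¬u = no λ { (_ , _ , _ , u) → ¬u u }

  lists≤ : ℕ → List (List (Fin n))
  lists≤ zero    = [] ∷ []
  lists≤ (suc k) = [] ∷ concatMap (λ x → map (x ∷_) (lists≤ k)) (allFin n)

  ∈-lists≤ : ∀ k (xs : List (Fin n)) → length xs ≤ k → xs ∈ lists≤ k
  ∈-lists≤ zero    []       _         = here refl
  ∈-lists≤ (suc k) []       _         = here refl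
  ∈-lists≤ (suc k) (x ∷ xs) (s≤s xs≤k) =
    there (∈-concatMap⁺ (λ y → map (y ∷_) (lists≤ k))
             (lose (∈-allFin x) (∈-map⁺ (x ∷_) (∈-lists≤ k xs xs≤k))))

  path-length : ∀ {r} → IsPathA E s t r → length r ≤ n
  path-length {r} (_ , _ , _ , u) =
    subst (length r ≤_) (length-tabulate (λ i → i)) (unique-length u (λ {v} _ → ∈-allFin v))

  Used? : ∀ a b → Dec (Used a b)
  Used? a b with any? (λ r → IsPathA? r ×-dec cp? _≟_ a b r) (lists≤ n)
  ... | yes found = yes (satisfied found)
  ... | no none   = no λ { (r , rP , ab∈r) → none (lose (∈-lists≤ n r (path-length rP)) (rP , ab∈r)) }

  -- Some edge of every closed walk c ∷ cs ++ [ c ] is unused: otherwise following the walk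
  -- would give c ≺ c.
  closed-walk-edge-removable : ¬ ContainsHomeoW E → ∀ c cs →
                               ∃₂ λ a b → ConsecPair a b (closeUp (c ∷ cs)) × SamePathA (removeEdge E a b) E s t
  closed-walk-edge-removable noW c cs with gap-or-chain Used? used⇒≺ (≺-transitive noW) c cs c
  ... | inj₁ (a , b , ab∈C , unused) = a , b , ab∈C , unused⇒removable unused
  ... | inj₂ c≺c                     = ⊥-elim (≺-irreflexive c≺c)

lemma3 : ∀ (n : ℕ) (E : EdgeRel n) (s t : Fin n) → IsSTGraph E s t →
         ¬ ContainsHomeoW E →
         (C : List (Fin n)) → IsSimpleCycle E C →
         ∃₂ λ a b → CycleEdge C a b × SamePathA (removeEdge E a b) E s t
lemma3 n E s t _ noW []       (C≢[] , _) = ⊥-elim (C≢[] refl)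
lemma3 n E s t _ noW (c ∷ cs) _          = Precedence.closed-walk-edge-removable E s t noW c cs
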